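{- For positive integers $n,m$, let $T_{\{n,m\}}$ be the rooted tree whose root has $n$ children, each of which has exactly $m$ children (which are leaves). Then the Node-Kayles Grundy value satisfies $$\mathcal{G}\left(T_{\{n,m\}}\right)=\begin{cases}1, & m \text{ even},\\ 2, & n \text{ and } m \text{ odd},\\ 3, & n \text{ even and } m \text{ odd}.\end{cases}$$
   Context: Node-Kayles is the impartial game played on a finite simple graph $G$: a move consists of choosing a vertex $v$ and deleting its closed neighbourhood $N_G[v]=\{v\}\cup N_G(v)$; under normal play, a player with no move loses. The Grundy value is defined recursively by $\mathcal{G}(\emptyset)=0$ and $\mathcal{G}(G)=\mathrm{mex}\{\mathcal{G}(G\setminus N_G[v]) : v\in V(G)\}$, where $\mathrm{mex}(S)$ is the least nonnegative integer not in $S$; for disjoint unions $\mathcal{G}(H\cup K)=\mathcal{G}(H)\oplus\mathcal{G}(K)$ (bitwise XOR). -}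

module Defs where

open import Data.Nat using (ℕ; zero; suc; _+_; _*_; _≡ᵇ_; _<ᵇ_; _∸_)
open import Data.Nat.DivMod using (_/_)
open import Data.Bool using (Bool; true; false; _∧_; _∨_; not; if_then_else_)
open import Data.Fin using (Fin; toℕ)
open import Data.List using (List; []; _∷_; map; filter; length)
open import Data.Vec using (Vec; lookup; tabulate)
open import Data.Fin.Subset using (Subset; ⊤)
open import Relation.Binary.PropositionalEquality using (_≡_)
open import Relation.Nullary.Decidable using (does)
open import Relation.Unary using (Decidable)
import Data.Bool.Properties
import Data.Nat

record Graph (k : ℕ) : Set where
  field
    adj    : Fin k → Fin k → Bool
    sym    : ∀ u v → adj u v ≡ adj v u
    irrefl : ∀ v → adj v v ≡ false
open Graph public

elemℕ : ℕ → List ℕ → Bool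
elemℕ x []       = false
elemℕ x (y ∷ ys) = (x ≡ᵇ y) ∨ elemℕ x ys

-- mex: least natural number not in the list (search bounded by length, which suffices)
mexFrom : ℕ → ℕ → List ℕ → ℕ
mexFrom zero    k xs = k
mexFrom (suc f) k xs = if elemℕ k xs then mexFrom f (suc k) xs else k

mex : List ℕ → ℕ
mex xs = mexFrom (length xs) 0 xs

allV : (k : ℕ) → List (Fin k)
allV k = Data.List.tabulate (λ i → i)

removeN : ∀ {k} → Graph k → Fin k → Subset k → Subset k
removeN G v S = tabulate λ u → lookup S u ∧ not (does (Data.Fin._≟_ u v) ∨ adj G v u)

-- Grundy value of the induced subgraph G[S], with fuel (each move removes ≥ 1 vertex,
-- so fuel k is enough for a graph on k vertices).
grundyF : ∀ {k} → ℕ → Graph k → Subset k → ℕ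
grundyF zero    G S = 0
grundyF {k} (suc f) G S =
  mex (map (λ v → grundyF f G (removeN G v S))
           (Data.List.filter (λ v → Data.Bool._≟_ (lookup S v) true) (allV k)))

grundy : ∀ {k} → Graph k → ℕ
grundy {k} G = grundyF k G ⊤

-- The tree T_{n,m}: vertices Fin (1 + n + n*m).
-- index 0 = root; index 1+i (i < n) = i-th child of the root;
-- index 1+n+i*m+j (i < n, j < m) = j-th leaf below child i.
-- parentℕ gives the (natural-number) index of the parent (root returns itself).
parentℕ : ℕ → ℕ → ℕ → ℕ
parentℕ n m zero = zero
parentℕ n m (suc x) = if x <ᵇ n then 0 else suc ((x ∸ n) / suc (m ∸ 1))

treeAdjℕ : ℕ → ℕ → ℕ → ℕ → Bool
treeAdjℕ n m a b =
  not (a ≡ᵇ b) ∧ ((parentℕ n m a ≡ᵇ b) ∨ (parentℕ n m b ≡ᵇ a))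

private
  ≡ᵇ-sym : ∀ a b → (a ≡ᵇ b) ≡ (b ≡ᵇ a)
  ≡ᵇ-sym zero zero = Relation.Binary.PropositionalEquality.refl
  ≡ᵇ-sym zero (suc b) = Relation.Binary.PropositionalEquality.refl
  ≡ᵇ-sym (suc a) zero = Relation.Binary.PropositionalEquality.refl
  ≡ᵇ-sym (suc a) (suc b) = ≡ᵇ-sym a b

  ≡ᵇ-refl : ∀ a → (a ≡ᵇ a) ≡ true
  ≡ᵇ-refl zero = Relation.Binary.PropositionalEquality.refl
  ≡ᵇ-refl (suc a) = ≡ᵇ-refl a

  treeAdj-sym : ∀ n m a b → treeAdjℕ n m a b ≡ treeAdjℕ n m b a
  treeAdj-sym n m a b
    rewrite ≡ᵇ-sym a b
          | Data.Bool.Properties.∨-comm (parentℕ n m a ≡ᵇ b) (parentℕ n m b ≡ᵇ a)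
          | ≡ᵇ-sym (parentℕ n m a) b | ≡ᵇ-sym (parentℕ n m b) a
    = Relation.Binary.PropositionalEquality.refl

  treeAdj-irrefl : ∀ n m a → treeAdjℕ n m a a ≡ false
  treeAdj-irrefl n m a rewrite ≡ᵇ-refl a = Relation.Binary.PropositionalEquality.refl

T[_,_] : (n m : ℕ) → Graph (suc (n + n * m))
T[ n , m ] = record
  { adj    = λ u v → treeAdjℕ n m (toℕ u) (toℕ v)
  ; sym    = λ u v → treeAdj-sym n m (toℕ u) (toℕ v)
  ; irrefl = λ v → treeAdj-irrefl n m (toℕ v)
  }

module Submission where

-- A position reachable from T_{n,m} keeps every surviving child together with all m of its
-- leaves, so it is the disjoint union of a core (the root with p full children or, once the
-- root is gone, p stars K_{1,m}) and q isolated leaves whose parent was removed.  Its Grundy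
-- value is the value of the core XOR (q mod 2), which depends only on whether the root
-- survives, whether p = 0, and the parities of p, q and m.  The four kinds of move (the root,
-- a child, a leaf under a surviving child, an isolated leaf) change (root, p, q) explicitly,
-- so checking that this closed form satisfies the mex recursion is a finite computation; and
-- a labelling that satisfies the mex recursion on a family of positions closed under moves
-- is the Grundy function.

open import Defs hiding (sym)
open import Data.Nat
  using (ℕ; zero; suc; pred; _+_; _*_; _∸_; _%_; _≤_; _<_; z≤n; _≡ᵇ_; _<ᵇ_; NonZero)
import Data.Nat as ℕ
open import Data.Nat.Properties
  using (≤-antisym; ≤-refl; ≤-trans; ≤-reflexive; <⇒≤; ≤∧≢⇒<; ≮⇒≥; <-≤-trans; ≤-pred; n≤0⇒n≡0;
         +-suc; +-assoc; +-identityʳ; *-comm; suc-injective; m+n∸m≡n; <⇒<ᵇ; allUpTo?; +-*-semiring)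
open import Data.Nat.DivMod using (_/_; +-distrib-/-∣ˡ; m*n/n≡m; m<n⇒m/n≡0)
open import Data.Nat.Divisibility using (divides)
open import Data.Bool as Bool using (Bool; true; false; _∧_; _∨_; _xor_; not; if_then_else_)
open import Data.Bool.Properties using (∧-conicalˡ; ∧-zeroʳ; ∧-identityʳ; not-involutive; xor-assoc; xor-same)
open import Data.Fin as Fin using (Fin; zero; suc; toℕ; punchIn; _↑ˡ_; _↑ʳ_; combine; remQuot; splitAt)
open import Data.Fin.Properties
  using (injective⇒≤; toℕ<n; toℕ-injective; punchInᵢ≢i; toℕ-↑ˡ; toℕ-↑ʳ; toℕ-combine;
         splitAt-↑ˡ; splitAt-↑ʳ; splitAt⁻¹-↑ˡ; splitAt⁻¹-↑ʳ; remQuot-combine; combine-remQuot)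
open import Data.Fin.Subset using (Subset; ∣_∣; ⊤)
open import Data.Fin.Subset.Properties using (p⊂q⇒∣p∣<∣q∣; ∣⊤∣≡n)
open import Data.List as List using (List; []; _∷_; [_]; _++_; length; map; filter)
open import Data.List.Membership.Propositional using (_∈_; _∉_)
open import Data.List.Membership.DecPropositional ℕ._≟_ using (_∈?_)
open import Data.List.Membership.Propositional.Properties using (∈-map⁺; ∈-map⁻; ∈-filter⁺; ∈-filter⁻; ∈-tabulate⁺)
open import Data.List.Relation.Unary.Any using (here; there)
open import Data.List.Relation.Unary.Any.Properties using (lookup-index)
open import Data.Product using (_×_; _,_; proj₁; proj₂; ∃-syntax; uncurry)
open import Data.Sum using (_⊎_; inj₁; inj₂; [_,_]′)
open import Data.Vec as Vec using ()
open import Data.Vec.Properties using (lookup∘tabulate; lookup-replicate; []=⇒lookup; lookup⇒[]=)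
open import Data.Vec.Functional using (removeAt)
open import Algebra.Properties.Semiring.Sum +-*-semiring
  using (sum; sum-remove; sum-cong-≗; sum-replicate-zero; ∑-distrib-+; *-distribʳ-sum)
open import Function using (id; _∘_)
open import Relation.Binary.Definitions using (DecidableEquality)
open import Relation.Binary.PropositionalEquality
  using (_≡_; _≢_; refl; sym; trans; cong; cong₂; subst; module ≡-Reasoning)
open import Relation.Nullary using (Dec; yes; no; does; proof; ¬_; ¬?; _×-dec_; _⊎-dec_; contradiction)
open import Relation.Nullary.Decidable using (True; toWitness; map′; dec-true; dec-false)
open import Relation.Nullary.Reflects using (det)

IsMex : ℕ → List ℕ → Set
IsMex t xs = t ∉ xs × (∀ {j} → j < t → j ∈ xs)

isMex? : ∀ t xs → Dec (IsMex t xs)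
isMex? t xs = ¬? (t ∈? xs) ×-dec allUpTo? (_∈? xs) t

elemℕ≡does∈? : ∀ x xs → elemℕ x xs ≡ does (x ∈? xs)
elemℕ≡does∈? x [] = refl
elemℕ≡does∈? x (y ∷ ys) = cong ((x ≡ᵇ y) ∨_) (elemℕ≡does∈? x ys)

mexFrom≡ : ∀ {xs t} fuel s → s ≤ t → t ≤ fuel + s →
           (∀ {j} → s ≤ j → j < t → j ∈ xs) → t ∉ xs → mexFrom fuel s xs ≡ t
mexFrom≡ zero s s≤t t≤s _ _ = ≤-antisym s≤t t≤s
mexFrom≡ {xs} {t} (suc fuel) s s≤t t≤ below t∉ rewrite elemℕ≡does∈? s xs with s ∈? xs
... | yes s∈ = mexFrom≡ fuel (suc s) (≤∧≢⇒< s≤t λ { refl → t∉ s∈ })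
                 (≤-trans t≤ (≤-reflexive (sym (+-suc fuel s)))) (λ s<j → below (<⇒≤ s<j)) t∉
... | no s∉ = ≤-antisym s≤t (≮⇒≥ λ s<t → s∉ (below ≤-refl s<t))

below⇒≤length : ∀ {xs t} → (∀ {j} → j < t → j ∈ xs) → t ≤ length xs
below⇒≤length {xs} below = injective⇒≤ λ {j} {j′} eq → toℕ-injective
  (trans (lookup-index (below (toℕ<n j))) (trans (cong (List.lookup xs) eq) (sym (lookup-index (below (toℕ<n j′))))))

mex≡ : ∀ {t xs} → IsMex t xs → mex xs ≡ t
mex≡ {xs = xs} (t∉ , below) =
  mexFrom≡ (length xs) 0 z≤n (≤-trans (below⇒≤length below) (≤-reflexive (sym (+-identityʳ _)))) (λ _ → below) t∉

module _ {k} (G : Graph k) where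

  lookup-removeN : ∀ v S u → Vec.lookup (removeN G v S) u ≡ Vec.lookup S u ∧ not (does (u Fin.≟ v) ∨ adj G v u)
  lookup-removeN v S u = lookup∘tabulate _ u

  removeN⊆ : ∀ v S {u} → Vec.lookup (removeN G v S) u ≡ true → Vec.lookup S u ≡ true
  removeN⊆ v S {u} eq = ∧-conicalˡ _ _ (trans (sym (lookup-removeN v S u)) eq)

  v∉removeN : ∀ v S → Vec.lookup (removeN G v S) v ≡ false
  v∉removeN v S rewrite lookup-removeN v S v | dec-true (v Fin.≟ v) refl = ∧-zeroʳ _

  ∣removeN∣<∣S∣ : ∀ v S → Vec.lookup S v ≡ true → ∣ removeN G v S ∣ < ∣ S ∣
  ∣removeN∣<∣S∣ v S v∈S = p⊂q⇒∣p∣<∣q∣ {p = removeN G v S} {q = S}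
    ( (λ {u} u∈ → lookup⇒[]= u S (removeN⊆ v S ([]=⇒lookup u∈)))
    , v , lookup⇒[]= v S v∈S , λ v∈ → contradiction (trans (sym ([]=⇒lookup v∈)) (v∉removeN v S)) λ ())

  present : Subset k → List (Fin k)
  present S = filter (λ v → Vec.lookup S v Bool.≟ true) (allV k)

  ∈-map-present⁺ : ∀ S {v} (h : Fin k → ℕ) → Vec.lookup S v ≡ true → h v ∈ map h (present S)
  ∈-map-present⁺ S {v} h v∈S = ∈-map⁺ h (∈-filter⁺ (λ v → Vec.lookup S v Bool.≟ true) (∈-tabulate⁺ v) v∈S)

  ∈-map-present⁻ : ∀ S {x} (h : Fin k → ℕ) → x ∈ map h (present S) → ∃[ v ] Vec.lookup S v ≡ true × h v ≡ x
  ∈-map-present⁻ S h x∈ with v , v∈ , refl ← ∈-map⁻ h x∈ =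
    v , proj₂ (∈-filter⁻ (λ v → Vec.lookup S v Bool.≟ true) {xs = allV k} v∈) , refl

  module _ (Inv : Subset k → Set) (label : Subset k → ℕ)
    (Inv-removeN : ∀ S {v} → Inv S → Vec.lookup S v ≡ true → Inv (removeN G v S))
    (label-avoid : ∀ S {v} → Inv S → Vec.lookup S v ≡ true → label (removeN G v S) ≢ label S)
    (label-reach : ∀ S {j} → Inv S → j < label S → ∃[ v ] Vec.lookup S v ≡ true × label (removeN G v S) ≡ j)
    where

    grundyF≡label : ∀ fuel S → Inv S → ∣ S ∣ ≤ fuel → grundyF fuel G S ≡ label S
    grundyF≡label zero S inv ∣S∣≤0 = sym (n≤0⇒n≡0 (≮⇒≥ λ 0<label →
      let v , v∈S , _ = label-reach S inv 0<label in
      contradiction (<-≤-trans (∣removeN∣<∣S∣ v S v∈S) ∣S∣≤0) λ ()))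
    grundyF≡label (suc fuel) S inv ∣S∣≤ = mex≡ (avoid , reach)
      where
      h : Fin k → ℕ
      h v = grundyF fuel G (removeN G v S)
      h≡label : ∀ {v} → Vec.lookup S v ≡ true → h v ≡ label (removeN G v S)
      h≡label v∈S = grundyF≡label fuel _ (Inv-removeN S inv v∈S) (≤-pred (≤-trans (∣removeN∣<∣S∣ _ S v∈S) ∣S∣≤))
      avoid : label S ∉ map h (present S)
      avoid t∈ with v , v∈S , eq ← ∈-map-present⁻ S h t∈ = label-avoid S inv v∈S (trans (sym (h≡label v∈S)) eq)
      reach : ∀ {j} → j < label S → j ∈ map h (present S)
      reach j< with v , v∈S , eq ← label-reach S inv j< =
        subst (_∈ map h (present S)) (trans (h≡label v∈S) eq) (∈-map-present⁺ S h v∈S)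

    grundy≡label : Inv ⊤ → grundy G ≡ label ⊤
    grundy≡label inv = grundyF≡label k ⊤ inv (≤-reflexive (∣⊤∣≡n k))

sum-update : ∀ {k} {f g : Fin k → ℕ} i {d} → (∀ j → j ≢ i → f j ≡ g j) → d + f i ≡ g i → d + sum f ≡ sum g
sum-update {suc k} {f} {g} i {d} agree d+fi≡gi = begin
  d + sum f                      ≡⟨ cong (d +_) (sum-remove {i = i} f) ⟩
  d + (f i + sum (removeAt f i)) ≡⟨ sym (+-assoc d (f i) _) ⟩
  d + f i + sum (removeAt f i)   ≡⟨ cong₂ _+_ d+fi≡gi (sum-cong-≗ λ j → agree (punchIn i j) (punchInᵢ≢i i j)) ⟩
  g i + sum (removeAt g i)       ≡⟨ sym (sum-remove {i = i} g) ⟩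
  sum g                          ∎
  where open ≡-Reasoning

sum-ones : ∀ k → sum {k} (λ _ → 1) ≡ k
sum-ones zero = refl
sum-ones (suc k) = cong suc (sum-ones k)

sum≢0 : ∀ {k} (f : Fin k → ℕ) → sum f ≢ 0 → ∃[ i ] f i ≢ 0
sum≢0 {zero} f s≢0 = contradiction refl s≢0
sum≢0 {suc k} f s≢0 with f zero ℕ.≟ 0
... | no f0≢0 = zero , f0≢0
... | yes f0≡0 = let i , fi≢0 = sum≢0 (f ∘ suc) (λ s≡0 → s≢0 (cong₂ _+_ f0≡0 s≡0)) in suc i , fi≢0

does-Fin≟ : ∀ {k} (a b : Fin k) → does (a Fin.≟ b) ≡ (toℕ a ≡ᵇ toℕ b)
does-Fin≟ a b = det (proof (a Fin.≟ b)) (proof (map′ toℕ-injective (cong toℕ) (toℕ a ℕ.≟ toℕ b)))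

≡ᵇ-sym : ∀ a b → (a ≡ᵇ b) ≡ (b ≡ᵇ a)
≡ᵇ-sym a b = det (proof (a ℕ.≟ b)) (proof (map′ sym sym (b ℕ.≟ a)))

∨-not-∧ : ∀ x y → x ∨ (not x ∧ y) ≡ x ∨ y
∨-not-∧ true y = refl
∨-not-∧ false y = refl

n+x<ᵇn≡false : ∀ n x → (n + x <ᵇ n) ≡ false
n+x<ᵇn≡false zero x = refl
n+x<ᵇn≡false (suc n) x = n+x<ᵇn≡false n x

[m*a+b]/m≡a : ∀ m .{{_ : NonZero m}} a b → b < m → (m * a + b) / m ≡ a
[m*a+b]/m≡a m a b b<m = begin
  (m * a + b) / m    ≡⟨ cong (λ x → (x + b) / m) (*-comm m a) ⟩
  (a * m + b) / m    ≡⟨ +-distrib-/-∣ˡ b (divides a refl) ⟩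
  a * m / m + b / m  ≡⟨ cong₂ _+_ (m*n/n≡m a m) (m<n⇒m/n≡0 b<m) ⟩
  a + 0              ≡⟨ +-identityʳ a ⟩
  a                  ∎
  where open ≡-Reasoning

ind : Bool → ℕ
ind b = if b then 1 else 0

ind≢0 : ∀ {b} → ind b ≢ 0 → b ≡ true
ind≢0 {true} _ = refl
ind≢0 {false} 0≢0 = contradiction refl 0≢0

odd : ℕ → Bool
odd zero = false
odd (suc zero) = true
odd (suc (suc n)) = odd n

odd-suc : ∀ n → odd (suc n) ≡ not (odd n)
odd-suc zero = refl
odd-suc (suc zero) = refl
odd-suc (suc (suc n)) = odd-suc n

odd-+ : ∀ a b → odd (a + b) ≡ odd a xor odd b
odd-+ zero b = refl
odd-+ (suc zero) b = odd-suc b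
odd-+ (suc (suc a)) b = odd-+ a b

odd-* : ∀ a b → odd (a * b) ≡ odd a ∧ odd b
odd-* zero b = refl
odd-* (suc zero) b = cong odd (+-identityʳ b)
odd-* (suc (suc a)) b = begin
  odd (b + (b + a * b))             ≡⟨ odd-+ b (b + a * b) ⟩
  odd b xor odd (b + a * b)         ≡⟨ cong (odd b xor_) (odd-+ b (a * b)) ⟩
  odd b xor (odd b xor odd (a * b)) ≡⟨ sym (xor-assoc (odd b) (odd b) _) ⟩
  (odd b xor odd b) xor odd (a * b) ≡⟨ cong (_xor odd (a * b)) (xor-same (odd b)) ⟩
  odd (a * b)                       ≡⟨ odd-* a b ⟩
  odd a ∧ odd b                     ∎
  where open ≡-Reasoning

odd≡[%2≡ᵇ1] : ∀ n → odd n ≡ (n % 2 ≡ᵇ 1)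
odd≡[%2≡ᵇ1] zero = refl
odd≡[%2≡ᵇ1] (suc zero) = refl
odd≡[%2≡ᵇ1] (suc (suc n)) = odd≡[%2≡ᵇ1] n

xor1 : ℕ → ℕ
xor1 zero = 1
xor1 (suc zero) = 0
xor1 (suc (suc x)) = suc (suc (xor1 x))

treeValue starsValue : Bool → ℕ → ℕ
treeValue mOdd p = if p ≡ᵇ 0 then 1 else if mOdd then (if odd p then 2 else 3) else 1
starsValue mOdd p = if odd p then (if mOdd then 1 else 2) else 0

value : (mOdd root : Bool) (p : ℕ) (qOdd : Bool) → ℕ
value mOdd r p qOdd = (if qOdd then xor1 else id) (if r then treeValue mOdd p else starsValue mOdd p)

-- The values after removing the root (the p m leaves of its children become isolated), a
-- child, a leaf below a child (its m - 1 siblings become isolated), or an isolated leaf.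
options : (mOdd root : Bool) (p q : ℕ) → List ℕ
options mOdd r p q =
  (if r then [ value mOdd false 0 (odd q xor (odd p ∧ mOdd)) ] else [])
  ++ (if 0 <ᵇ p then value mOdd false (pred p) (odd q) ∷ value mOdd r (pred p) (not mOdd xor odd q) ∷ [] else [])
  ++ (if 0 <ᵇ q then [ value mOdd r p (odd (pred q)) ] else [])

∀Bool? : ∀ {P : Bool → Set} → (∀ b → Dec (P b)) → Dec (∀ b → P b)
∀Bool? P? = map′ (λ (f , t) → λ { false → f ; true → t }) (λ all → all false , all true) (P? false ×-dec P? true)

value-isMex-decided : ∀ {p q} {_ : True (∀Bool? λ mOdd → ∀Bool? λ r → isMex? (value mOdd r p (odd q)) (options mOdd r p q))} →
                      ∀ mOdd r → IsMex (value mOdd r p (odd q)) (options mOdd r p q)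
value-isMex-decided {_} {_} {ok} = toWitness ok

-- For p ≥ 2 and q ≥ 1 both `value` and `options` see p and q only through their parities,
-- so the first two clauses are definitional reductions; the twelve small cases are decided.
value-isMex : ∀ mOdd r p q → IsMex (value mOdd r p (odd q)) (options mOdd r p q)
value-isMex mOdd r (suc (suc (suc (suc p)))) q = value-isMex mOdd r (suc (suc p)) q
value-isMex mOdd r p (suc (suc (suc q))) = value-isMex mOdd r p (suc q)
value-isMex mOdd r 0 0 = value-isMex-decided {0} {0} mOdd r
value-isMex mOdd r 0 1 = value-isMex-decided {0} {1} mOdd r
value-isMex mOdd r 0 2 = value-isMex-decided {0} {2} mOdd r
value-isMex mOdd r 1 0 = value-isMex-decided {1} {0} mOdd r
value-isMex mOdd r 1 1 = value-isMex-decided {1} {1} mOdd r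
value-isMex mOdd r 1 2 = value-isMex-decided {1} {2} mOdd r
value-isMex mOdd r 2 0 = value-isMex-decided {2} {0} mOdd r
value-isMex mOdd r 2 1 = value-isMex-decided {2} {1} mOdd r
value-isMex mOdd r 2 2 = value-isMex-decided {2} {2} mOdd r
value-isMex mOdd r 3 0 = value-isMex-decided {3} {0} mOdd r
value-isMex mOdd r 3 1 = value-isMex-decided {3} {1} mOdd r
value-isMex mOdd r 3 2 = value-isMex-decided {3} {2} mOdd r

∈-options-root : ∀ {mOdd r} p q → r ≡ true → value mOdd false 0 (odd q xor (odd p ∧ mOdd)) ∈ options mOdd r p q
∈-options-root _ _ refl = here refl

∈-options-child : ∀ {mOdd} r {p} q → p ≢ 0 → value mOdd false (pred p) (odd q) ∈ options mOdd r p q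
∈-options-child _ {zero} _ p≢0 = contradiction refl p≢0
∈-options-child true {suc _} _ _ = there (here refl)
∈-options-child false {suc _} _ _ = here refl

∈-options-leaf : ∀ {mOdd} r {p} q → p ≢ 0 → value mOdd r (pred p) (not mOdd xor odd q) ∈ options mOdd r p q
∈-options-leaf _ {zero} _ p≢0 = contradiction refl p≢0
∈-options-leaf true {suc _} _ _ = there (there (here refl))
∈-options-leaf false {suc _} _ _ = there (here refl)

∈-options-loose : ∀ {mOdd} r p {q} → q ≢ 0 → value mOdd r p (odd (pred q)) ∈ options mOdd r p q
∈-options-loose _ _ {zero} q≢0 = contradiction refl q≢0
∈-options-loose true zero {suc _} _ = there (here refl)
∈-options-loose true (suc _) {suc _} _ = there (there (there (here refl)))
∈-options-loose false zero {suc _} _ = here refl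
∈-options-loose false (suc _) {suc _} _ = there (there (here refl))

∈-nonRootOptions⁻ : ∀ {p q} {a b c x : ℕ} →
                    x ∈ (if 0 <ᵇ p then a ∷ b ∷ [] else []) ++ (if 0 <ᵇ q then [ c ] else []) →
                    (p ≢ 0 × (x ≡ a ⊎ x ≡ b)) ⊎ (q ≢ 0 × x ≡ c)
∈-nonRootOptions⁻ {suc _} (here eq) = inj₁ ((λ ()) , inj₁ eq)
∈-nonRootOptions⁻ {suc _} (there (here eq)) = inj₁ ((λ ()) , inj₂ eq)
∈-nonRootOptions⁻ {suc _} {suc _} (there (there (here eq))) = inj₂ ((λ ()) , eq)
∈-nonRootOptions⁻ {zero} {suc _} (here eq) = inj₂ ((λ ()) , eq)

options⁻ : ∀ {mOdd r p q x} → x ∈ options mOdd r p q →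
           (r ≡ true × x ≡ value mOdd false 0 (odd q xor (odd p ∧ mOdd)))
           ⊎ (p ≢ 0 × (x ≡ value mOdd false (pred p) (odd q) ⊎ x ≡ value mOdd r (pred p) (not mOdd xor odd q)))
           ⊎ (q ≢ 0 × x ≡ value mOdd r p (odd (pred q)))
options⁻ {r = true} (here eq) = inj₁ (refl , eq)
options⁻ {r = true} (there x∈) = inj₂ (∈-nonRootOptions⁻ x∈)
options⁻ {r = false} x∈ = inj₂ (∈-nonRootOptions⁻ x∈)

-- Children carry m = suc m′ leaves, so that the divisor suc (m ∸ 1) of parentℕ is m definitionally.
module Tree (n m′ : ℕ) where

  m : ℕ
  m = suc m′

  K : ℕ
  K = suc (n + n * m)

  data Node : Set where
    root  : Node
    child : Fin n → Node
    leaf  : Fin n → Fin m → Node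

  parent : Node → Node
  parent root       = root
  parent (child _)  = root
  parent (leaf i _) = child i

  ⌜_⌝ : Node → Fin K
  ⌜ root ⌝     = zero
  ⌜ child i ⌝  = suc (i ↑ˡ n * m)
  ⌜ leaf i j ⌝ = suc (n ↑ʳ combine i j)

  decode : Fin K → Node
  decode zero    = root
  decode (suc v) = [ child , uncurry leaf ∘ remQuot m ]′ (splitAt n v)

  decode-⌜⌝ : ∀ x → decode ⌜ x ⌝ ≡ x
  decode-⌜⌝ root = refl
  decode-⌜⌝ (child i) rewrite splitAt-↑ˡ n i (n * m) = refl
  decode-⌜⌝ (leaf i j) rewrite splitAt-↑ʳ n (n * m) (combine i j) = cong (uncurry leaf) (remQuot-combine i j)

  ⌜⌝-decode : ∀ v → ⌜ decode v ⌝ ≡ v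
  ⌜⌝-decode zero = refl
  ⌜⌝-decode (suc v) with splitAt n v in eq
  ... | inj₁ i = cong suc (splitAt⁻¹-↑ˡ eq)
  ... | inj₂ c = cong suc (trans (cong (n ↑ʳ_) (combine-remQuot {n} m c)) (splitAt⁻¹-↑ʳ eq))

  toℕ⌜⌝-injective : ∀ {x y} → toℕ ⌜ x ⌝ ≡ toℕ ⌜ y ⌝ → x ≡ y
  toℕ⌜⌝-injective {x} {y} eq = trans (sym (decode-⌜⌝ x)) (trans (cong decode (toℕ-injective eq)) (decode-⌜⌝ y))

  data Coded : Fin K → Set where
    code : ∀ x → Coded ⌜ x ⌝

  coded : ∀ v → Coded v
  coded v = subst Coded (⌜⌝-decode v) (code (decode v))

  toℕ-parent : ∀ x → parentℕ n m (toℕ ⌜ x ⌝) ≡ toℕ ⌜ parent x ⌝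
  toℕ-parent root = refl
  toℕ-parent (child i) rewrite toℕ-↑ˡ i (n * m) with toℕ i <ᵇ n | <⇒<ᵇ (toℕ<n i)
  ... | true | _ = refl
  toℕ-parent (leaf i j) rewrite toℕ-↑ʳ n (combine i j) | n+x<ᵇn≡false n (toℕ (combine i j)) = cong suc (begin
    (n + toℕ (combine i j) ∸ n) / m ≡⟨ cong (_/ m) (m+n∸m≡n n _) ⟩
    toℕ (combine i j) / m           ≡⟨ cong (_/ m) (toℕ-combine i j) ⟩
    (m * toℕ i + toℕ j) / m         ≡⟨ [m*a+b]/m≡a m (toℕ i) (toℕ j) (toℕ<n j) ⟩
    toℕ i                           ≡⟨ sym (toℕ-↑ˡ i (n * m)) ⟩
    toℕ (i ↑ˡ n * m)                ∎)
    where open ≡-Reasoning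

  _≟_ : DecidableEquality Node
  x ≟ y = map′ toℕ⌜⌝-injective (cong (toℕ ∘ ⌜_⌝)) (toℕ ⌜ x ⌝ ℕ.≟ toℕ ⌜ y ⌝)

  _∈N[_] : Node → Node → Set
  u ∈N[ v ] = u ≡ v ⊎ parent v ≡ u ⊎ parent u ≡ v

  _∈N?_ : ∀ u v → Dec (u ∈N[ v ])
  u ∈N? v = u ≟ v ⊎-dec parent v ≟ u ⊎-dec parent u ≟ v

  leaf∈N⇒child∈N : ∀ {i j v} → leaf i j ∈N[ v ] → child i ∈N[ v ]
  leaf∈N⇒child∈N (inj₁ refl) = inj₂ (inj₁ refl)
  leaf∈N⇒child∈N (inj₂ (inj₂ refl)) = inj₁ refl
  leaf∈N⇒child∈N {v = root} (inj₂ (inj₁ ()))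
  leaf∈N⇒child∈N {v = child _} (inj₂ (inj₁ ()))
  leaf∈N⇒child∈N {v = leaf _ _} (inj₂ (inj₁ ()))

  self∈N : ∀ {v} → v ∈N[ v ]
  self∈N = inj₁ refl

  child∈N[root] : ∀ {i} → child i ∈N[ root ]
  child∈N[root] = inj₂ (inj₂ refl)

  leaf∉N[root] : ∀ {i j} → ¬ leaf i j ∈N[ root ]
  leaf∉N[root] (inj₂ (inj₁ ()))
  leaf∉N[root] (inj₂ (inj₂ ()))

  root∈N[child] : ∀ {i} → root ∈N[ child i ]
  root∈N[child] = inj₂ (inj₁ refl)

  leaf∈N[child] : ∀ {i j} → leaf i j ∈N[ child i ]
  leaf∈N[child] = inj₂ (inj₂ refl)

  root∉N[leaf] : ∀ {i j} → ¬ root ∈N[ leaf i j ]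
  root∉N[leaf] (inj₂ (inj₁ ()))
  root∉N[leaf] (inj₂ (inj₂ ()))

  sibling∉N : ∀ {i j j′} → j′ ≢ j → ¬ leaf i j′ ∈N[ leaf i j ]
  sibling∉N j′≢j (inj₁ refl) = j′≢j refl
  sibling∉N _ (inj₂ (inj₁ ()))
  sibling∉N _ (inj₂ (inj₂ ()))

  data InBranch (i : Fin n) : Node → Set where
    at-child : InBranch i (child i)
    at-leaf  : ∀ j → InBranch i (leaf i j)

  branch∈N : ∀ {i v} → InBranch i v → child i ∈N[ v ]
  branch∈N at-child = inj₁ refl
  branch∈N (at-leaf _) = inj₂ (inj₁ refl)

  otherBranch∉N : ∀ {i i′ v} → InBranch i v → i′ ≢ i → ¬ child i′ ∈N[ v ]
  otherBranch∉N at-child i′≢i (inj₁ refl) = i′≢i refl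
  otherBranch∉N at-child _ (inj₂ (inj₁ ()))
  otherBranch∉N at-child _ (inj₂ (inj₂ ()))
  otherBranch∉N (at-leaf _) _ (inj₁ ())
  otherBranch∉N (at-leaf _) i′≢i (inj₂ (inj₁ refl)) = i′≢i refl
  otherBranch∉N (at-leaf _) _ (inj₂ (inj₂ ()))

  has : Subset K → Node → Bool
  has S x = Vec.lookup S ⌜ x ⌝

  _⊖_ : Subset K → Node → Subset K
  S ⊖ v = removeN T[ n , m ] ⌜ v ⌝ S

  has-⊖ : ∀ S v u → has (S ⊖ v) u ≡ has S u ∧ not (does (u ∈N? v))
  has-⊖ S v u = trans (lookup-removeN T[ n , m ] ⌜ v ⌝ S ⌜ u ⌝) (cong (λ b → has S u ∧ not b) closedNbr≡)
    where
    open ≡-Reasoning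
    U V : ℕ
    U = toℕ ⌜ u ⌝
    V = toℕ ⌜ v ⌝
    closedNbr≡ : does (⌜ u ⌝ Fin.≟ ⌜ v ⌝) ∨ treeAdjℕ n m V U ≡ does (u ∈N? v)
    closedNbr≡ = begin
      does (⌜ u ⌝ Fin.≟ ⌜ v ⌝) ∨ (not (V ≡ᵇ U) ∧ ((parentℕ n m V ≡ᵇ U) ∨ (parentℕ n m U ≡ᵇ V)))
        ≡⟨ cong₂ (λ a b → a ∨ (not b ∧ ((parentℕ n m V ≡ᵇ U) ∨ (parentℕ n m U ≡ᵇ V))))
                 (does-Fin≟ ⌜ u ⌝ ⌜ v ⌝) (≡ᵇ-sym V U) ⟩
      (U ≡ᵇ V) ∨ (not (U ≡ᵇ V) ∧ ((parentℕ n m V ≡ᵇ U) ∨ (parentℕ n m U ≡ᵇ V)))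
        ≡⟨ ∨-not-∧ (U ≡ᵇ V) _ ⟩
      (U ≡ᵇ V) ∨ ((parentℕ n m V ≡ᵇ U) ∨ (parentℕ n m U ≡ᵇ V))
        ≡⟨ cong₂ (λ a b → (U ≡ᵇ V) ∨ ((a ≡ᵇ U) ∨ (b ≡ᵇ V))) (toℕ-parent v) (toℕ-parent u) ⟩
      does (u ∈N? v) ∎

  ⊖-∈N : ∀ S {v u} → u ∈N[ v ] → has (S ⊖ v) u ≡ false
  ⊖-∈N S {v} {u} u∈ rewrite has-⊖ S v u | dec-true (u ∈N? v) u∈ = ∧-zeroʳ _

  ⊖-∉N : ∀ S {v u} → ¬ u ∈N[ v ] → has (S ⊖ v) u ≡ has S u
  ⊖-∉N S {v} {u} u∉ rewrite has-⊖ S v u | dec-false (u ∈N? v) u∉ = ∧-identityʳ _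

  children : Subset K → ℕ
  children S = sum λ i → ind (has S (child i))

  leavesBelow : Subset K → Fin n → ℕ
  leavesBelow S i = sum λ j → ind (has S (leaf i j))

  looseBelow : Subset K → Fin n → ℕ
  looseBelow S i = if has S (child i) then 0 else leavesBelow S i

  looseLeaves : Subset K → ℕ
  looseLeaves S = sum (looseBelow S)

  Full : Subset K → Set
  Full S = ∀ i j → has S (child i) ≡ true → has S (leaf i j) ≡ true

  Full-⊖ : ∀ {S} v → Full S → Full (S ⊖ v)
  Full-⊖ {S} v full i j c′ = trans (⊖-∉N S (c∉ ∘ leaf∈N⇒child∈N)) (full i j (trans (sym (⊖-∉N S c∉)) c′))
    where
    c∉ : ¬ child i ∈N[ v ]
    c∉ c∈ = contradiction (trans (sym c′) (⊖-∈N S c∈)) λ ()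

  looseBelow-present : ∀ S {i} → has S (child i) ≡ true → looseBelow S i ≡ 0
  looseBelow-present S {i} c = cong (λ b → if b then 0 else leavesBelow S i) c

  looseBelow-absent : ∀ S {i} → has S (child i) ≡ false → looseBelow S i ≡ leavesBelow S i
  looseBelow-absent S {i} c = cong (λ b → if b then 0 else leavesBelow S i) c

  label : Subset K → ℕ
  label S = value (odd m) (has S root) (children S) (odd (looseLeaves S))

  optionsOf : Subset K → List ℕ
  optionsOf S = options (odd m) (has S root) (children S) (looseLeaves S)

  label≡ : ∀ S {r p qOdd} → has S root ≡ r → children S ≡ p → odd (looseLeaves S) ≡ qOdd →
           label S ≡ value (odd m) r p qOdd
  label≡ S refl refl refl = refl

  odd-m′ : odd m′ ≡ not (odd m)
  odd-m′ = trans (sym (not-involutive (odd m′))) (cong not (sym (odd-suc m′)))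

  module _ (S : Subset K) where

    leavesBelow-full : ∀ {i} → Full S → has S (child i) ≡ true → leavesBelow S i ≡ m
    leavesBelow-full {i} full c = trans (sum-cong-≗ λ j → cong ind (full i j c)) (sum-ones m)

    looseBelow-⊖ : ∀ {i v} → ¬ child i ∈N[ v ] → looseBelow (S ⊖ v) i ≡ looseBelow S i
    looseBelow-⊖ c∉ = cong₂ (λ b l → if b then 0 else l) (⊖-∉N S c∉)
                            (sum-cong-≗ λ j → cong ind (⊖-∉N S (c∉ ∘ leaf∈N⇒child∈N {j = j})))

    leavesBelow-⊖leaf : ∀ {i j} → has S (leaf i j) ≡ true → suc (leavesBelow (S ⊖ leaf i j) i) ≡ leavesBelow S i
    leavesBelow-⊖leaf {i} {j} l = sum-update j
      (λ j′ j′≢j → cong ind (⊖-∉N S (sibling∉N j′≢j)))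
      (trans (cong (λ b → 1 + ind b) (⊖-∈N S (self∈N {leaf i j}))) (cong ind (sym l)))

    children-⊖root : children (S ⊖ root) ≡ 0
    children-⊖root = trans (sum-cong-≗ λ i → cong ind (⊖-∈N S (child∈N[root] {i}))) (sum-replicate-zero n)

    children-⊖branch : ∀ {i v} → InBranch i v → has S (child i) ≡ true → suc (children (S ⊖ v)) ≡ children S
    children-⊖branch b c = sum-update _
      (λ i′ i′≢i → cong ind (⊖-∉N S (otherBranch∉N b i′≢i)))
      (trans (cong (λ x → 1 + ind x) (⊖-∈N S (branch∈N b))) (cong ind (sym c)))

    children-⊖loose : ∀ {i j} → has S (child i) ≡ false → children (S ⊖ leaf i j) ≡ children S
    children-⊖loose {j = j} c = sum-update _
      (λ i′ i′≢i → cong ind (⊖-∉N S (otherBranch∉N (at-leaf j) i′≢i)))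
      (trans (cong ind (⊖-∈N S (branch∈N (at-leaf j)))) (cong ind (sym c)))

    looseLeaves-⊖root : Full S → looseLeaves (S ⊖ root) ≡ looseLeaves S + children S * m
    looseLeaves-⊖root full = begin
      looseLeaves (S ⊖ root)                          ≡⟨ sum-cong-≗ split ⟩
      sum (λ i → looseBelow S i + childPresent i * m) ≡⟨ ∑-distrib-+ (looseBelow S) _ ⟩
      looseLeaves S + sum (λ i → childPresent i * m)  ≡⟨ cong (looseLeaves S +_) (sym (*-distribʳ-sum m childPresent)) ⟩
      looseLeaves S + children S * m                  ∎
      where
      open ≡-Reasoning
      childPresent : Fin n → ℕ
      childPresent i = ind (has S (child i))
      split : ∀ i → looseBelow (S ⊖ root) i ≡ looseBelow S i + childPresent i * m
      split i = trans root-removed (leaves-split (has S (child i)) refl)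
        where
        root-removed : looseBelow (S ⊖ root) i ≡ leavesBelow S i
        root-removed = trans (looseBelow-absent (S ⊖ root) (⊖-∈N S child∈N[root]))
          (sum-cong-≗ λ j → cong ind (⊖-∉N S (leaf∉N[root] {i} {j})))
        leaves-split : ∀ b → has S (child i) ≡ b → leavesBelow S i ≡ looseBelow S i + ind b * m
        leaves-split true c = trans (leavesBelow-full full c) (sym (cong₂ _+_ (looseBelow-present S c) (+-identityʳ m)))
        leaves-split false c = sym (trans (cong₂ _+_ (looseBelow-absent S c) refl) (+-identityʳ _))

    looseLeaves-⊖child : ∀ {i} → has S (child i) ≡ true → looseLeaves (S ⊖ child i) ≡ looseLeaves S
    looseLeaves-⊖child {i} c = sum-update {f = looseBelow (S ⊖ child i)} {g = looseBelow S} i {0}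
      (λ i′ i′≢i → looseBelow-⊖ (otherBranch∉N at-child i′≢i))
      (begin
        looseBelow (S ⊖ child i) i  ≡⟨ looseBelow-absent (S ⊖ child i) (⊖-∈N S (self∈N {child i})) ⟩
        leavesBelow (S ⊖ child i) i ≡⟨ sum-cong-≗ (λ j → cong ind (⊖-∈N S (leaf∈N[child] {i} {j}))) ⟩
        sum {m} (λ _ → 0)           ≡⟨ sum-replicate-zero m ⟩
        0                           ≡⟨ sym (looseBelow-present S c) ⟩
        looseBelow S i              ∎)
      where open ≡-Reasoning

    looseLeaves-⊖leaf : ∀ {i j} → Full S → has S (child i) ≡ true → looseLeaves (S ⊖ leaf i j) ≡ m′ + looseLeaves S
    looseLeaves-⊖leaf {i} {j} full c = sym (sum-update {f = looseBelow S} {g = looseBelow (S ⊖ leaf i j)} i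
      (λ i′ i′≢i → sym (looseBelow-⊖ (otherBranch∉N (at-leaf j) i′≢i)))
      (begin
        m′ + looseBelow S i              ≡⟨ cong (m′ +_) (looseBelow-present S c) ⟩
        m′ + 0                           ≡⟨ +-identityʳ m′ ⟩
        m′                               ≡⟨ suc-injective (sym (trans (leavesBelow-⊖leaf (full i j c))
                                                                      (leavesBelow-full full c))) ⟩
        leavesBelow (S ⊖ leaf i j) i     ≡⟨ sym (looseBelow-absent (S ⊖ leaf i j) (⊖-∈N S (branch∈N (at-leaf j)))) ⟩
        looseBelow (S ⊖ leaf i j) i      ∎))
      where open ≡-Reasoning

    looseLeaves-⊖loose : ∀ {i j} → has S (child i) ≡ false → has S (leaf i j) ≡ true →
                         suc (looseLeaves (S ⊖ leaf i j)) ≡ looseLeaves S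
    looseLeaves-⊖loose {i} {j} c l = sum-update {f = looseBelow (S ⊖ leaf i j)} {g = looseBelow S} i
      (λ i′ i′≢i → looseBelow-⊖ (otherBranch∉N (at-leaf j) i′≢i))
      (begin
        suc (looseBelow (S ⊖ leaf i j) i)  ≡⟨ cong suc (looseBelow-absent (S ⊖ leaf i j) (⊖-∈N S (branch∈N (at-leaf j)))) ⟩
        suc (leavesBelow (S ⊖ leaf i j) i) ≡⟨ leavesBelow-⊖leaf l ⟩
        leavesBelow S i                    ≡⟨ sym (looseBelow-absent S c) ⟩
        looseBelow S i                     ∎)
      where open ≡-Reasoning

    label-⊖root : Full S → label (S ⊖ root) ≡ value (odd m) false 0 (odd (looseLeaves S) xor (odd (children S) ∧ odd m))
    label-⊖root full = label≡ (S ⊖ root) (⊖-∈N S (self∈N {root})) children-⊖root (begin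
      odd (looseLeaves (S ⊖ root))                          ≡⟨ cong odd (looseLeaves-⊖root full) ⟩
      odd (looseLeaves S + children S * m)                  ≡⟨ odd-+ (looseLeaves S) (children S * m) ⟩
      odd (looseLeaves S) xor odd (children S * m)          ≡⟨ cong (odd (looseLeaves S) xor_) (odd-* (children S) m) ⟩
      odd (looseLeaves S) xor (odd (children S) ∧ odd m)    ∎)
      where open ≡-Reasoning

    label-⊖child : ∀ {i} → has S (child i) ≡ true →
                   label (S ⊖ child i) ≡ value (odd m) false (pred (children S)) (odd (looseLeaves S))
    label-⊖child {i} c = label≡ (S ⊖ child i) (⊖-∈N S (root∈N[child] {i}))
      (cong pred (children-⊖branch at-child c)) (cong odd (looseLeaves-⊖child c))

    label-⊖leaf : ∀ {i j} → Full S → has S (child i) ≡ true →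
                  label (S ⊖ leaf i j) ≡ value (odd m) (has S root) (pred (children S)) (not (odd m) xor odd (looseLeaves S))
    label-⊖leaf {i} {j} full c = label≡ (S ⊖ leaf i j) (⊖-∉N S (root∉N[leaf] {i} {j}))
      (cong pred (children-⊖branch (at-leaf j) c)) (begin
      odd (looseLeaves (S ⊖ leaf _ j))        ≡⟨ cong odd (looseLeaves-⊖leaf full c) ⟩
      odd (m′ + looseLeaves S)                ≡⟨ odd-+ m′ (looseLeaves S) ⟩
      odd m′ xor odd (looseLeaves S)          ≡⟨ cong (_xor odd (looseLeaves S)) odd-m′ ⟩
      not (odd m) xor odd (looseLeaves S)     ∎)
      where open ≡-Reasoning

    label-⊖loose : ∀ {i j} → has S (child i) ≡ false → has S (leaf i j) ≡ true →
                   label (S ⊖ leaf i j) ≡ value (odd m) (has S root) (children S) (odd (pred (looseLeaves S)))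
    label-⊖loose {i} {j} c l = label≡ (S ⊖ leaf i j) (⊖-∉N S (root∉N[leaf] {i} {j}))
      (children-⊖loose c) (cong (odd ∘ pred) (looseLeaves-⊖loose c l))

    children≢0 : ∀ {i} → has S (child i) ≡ true → children S ≢ 0
    children≢0 c p≡0 = contradiction (trans (children-⊖branch at-child c) p≡0) λ ()

    looseLeaves≢0 : ∀ {i j} → has S (child i) ≡ false → has S (leaf i j) ≡ true → looseLeaves S ≢ 0
    looseLeaves≢0 c l q≡0 = contradiction (trans (looseLeaves-⊖loose c l) q≡0) λ ()

    someChild : children S ≢ 0 → ∃[ i ] has S (child i) ≡ true
    someChild p≢0 = let i , nz = sum≢0 (λ i → ind (has S (child i))) p≢0 in i , ind≢0 nz

    someLooseLeaf : looseLeaves S ≢ 0 → ∃[ i ] ∃[ j ] has S (child i) ≡ false × has S (leaf i j) ≡ true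
    someLooseLeaf q≢0 = let i , nz = sum≢0 (looseBelow S) q≢0 in below i nz (has S (child i)) refl
      where
      below : ∀ i → looseBelow S i ≢ 0 → ∀ b → has S (child i) ≡ b →
              ∃[ i ] ∃[ j ] has S (child i) ≡ false × has S (leaf i j) ≡ true
      below i nz true c = contradiction (looseBelow-present S c) nz
      below i nz false c =
        let j , nzj = sum≢0 (λ j → ind (has S (leaf i j))) (nz ∘ trans (looseBelow-absent S c)) in i , j , c , ind≢0 nzj

    label-⊖∈optionsOf : ∀ x → Full S → has S x ≡ true → label (S ⊖ x) ∈ optionsOf S
    label-⊖∈optionsOf root full r =
      subst (_∈ optionsOf S) (sym (label-⊖root full)) (∈-options-root (children S) (looseLeaves S) r)
    label-⊖∈optionsOf (child i) full c =
      subst (_∈ optionsOf S) (sym (label-⊖child c)) (∈-options-child (has S root) (looseLeaves S) (children≢0 c))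
    label-⊖∈optionsOf (leaf i j) full l with has S (child i) in c
    ... | true  = subst (_∈ optionsOf S) (sym (label-⊖leaf full c))
                        (∈-options-leaf (has S root) (looseLeaves S) (children≢0 c))
    ... | false = subst (_∈ optionsOf S) (sym (label-⊖loose c l))
                        (∈-options-loose (has S root) (children S) (looseLeaves≢0 c l))

    optionsOf⁻ : ∀ {x} → Full S → x ∈ optionsOf S → ∃[ v ] Vec.lookup S v ≡ true × label (removeN T[ n , m ] v S) ≡ x
    optionsOf⁻ full x∈ with options⁻ {odd m} {has S root} {children S} {looseLeaves S} x∈
    ... | inj₁ (r , refl) = ⌜ root ⌝ , r , label-⊖root full
    ... | inj₂ (inj₁ (p≢0 , inj₁ refl)) = let i , c = someChild p≢0 in ⌜ child i ⌝ , c , label-⊖child c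
    ... | inj₂ (inj₁ (p≢0 , inj₂ refl)) = let i , c = someChild p≢0 in ⌜ leaf i zero ⌝ , full i zero c , label-⊖leaf full c
    ... | inj₂ (inj₂ (q≢0 , refl)) = let i , j , c , l = someLooseLeaf q≢0 in ⌜ leaf i j ⌝ , l , label-⊖loose c l

  label-isMex : ∀ S → IsMex (label S) (optionsOf S)
  label-isMex S = value-isMex (odd m) (has S root) (children S) (looseLeaves S)

  Full-removeN : ∀ S {v} → Full S → Vec.lookup S v ≡ true → Full (removeN T[ n , m ] v S)
  Full-removeN S {v} full _ with coded v
  ... | code x = Full-⊖ {S} x full

  label-avoid : ∀ S {v} → Full S → Vec.lookup S v ≡ true → label (removeN T[ n , m ] v S) ≢ label S
  label-avoid S {v} full v∈S with coded v
  ... | code x = λ eq → proj₁ (label-isMex S) (subst (_∈ optionsOf S) eq (label-⊖∈optionsOf S x full v∈S))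

  label-reach : ∀ S {j} → Full S → j < label S → ∃[ v ] Vec.lookup S v ≡ true × label (removeN T[ n , m ] v S) ≡ j
  label-reach S full j< = optionsOf⁻ S full (proj₂ (label-isMex S) j<)

  Full-⊤ : Full ⊤
  Full-⊤ i j _ = lookup-replicate ⌜ leaf i j ⌝ true

  label-⊤ : label ⊤ ≡ value (odd m) true n false
  label-⊤ = label≡ ⊤ (lookup-replicate ⌜ root ⌝ true)
    (trans (sum-cong-≗ λ i → cong ind (lookup-replicate ⌜ child i ⌝ true)) (sum-ones n))
    (cong odd (trans (sum-cong-≗ λ i → looseBelow-present ⊤ (lookup-replicate ⌜ child i ⌝ true)) (sum-replicate-zero n)))

  grundy-T : grundy T[ n , m ] ≡ treeValue (odd m) n
  grundy-T = trans (grundy≡label T[ n , m ] Full label Full-removeN label-avoid label-reach Full-⊤) label-⊤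

grundy-T-by-parity : ∀ n m → 1 ≤ n → 1 ≤ m →
                     grundy T[ n , m ] ≡ (if m % 2 ≡ᵇ 1 then (if n % 2 ≡ᵇ 1 then 2 else 3) else 1)
grundy-T-by-parity (suc n) (suc m) _ _ = trans (Tree.grundy-T (suc n) m)
  (cong₂ (λ a b → if b then (if a then 2 else 3) else 1) (odd≡[%2≡ᵇ1] (suc n)) (odd≡[%2≡ᵇ1] (suc m)))

mainTheorem2 : (n m : ℕ) → 1 Data.Nat.≤ n → 1 Data.Nat.≤ m →
    ((m % 2 ≡ 0 → grundy T[ n , m ] ≡ 1)
    × (n % 2 ≡ 1 → m % 2 ≡ 1 → grundy T[ n , m ] ≡ 2)
    × (n % 2 ≡ 0 → m % 2 ≡ 1 → grundy T[ n , m ] ≡ 3))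
mainTheorem2 n m 1≤n 1≤m =
    (λ m-even → trans byParity (cong (λ b → if b ≡ᵇ 1 then (if n % 2 ≡ᵇ 1 then 2 else 3) else 1) m-even))
  , (λ n-odd m-odd → trans byParity (cong₂ (λ a b → if b ≡ᵇ 1 then (if a ≡ᵇ 1 then 2 else 3) else 1) n-odd m-odd))
  , (λ n-even m-odd → trans byParity (cong₂ (λ a b → if b ≡ᵇ 1 then (if a ≡ᵇ 1 then 2 else 3) else 1) n-even m-odd))
  where
  byParity : grundy T[ n , m ] ≡ (if m % 2 ≡ᵇ 1 then (if n % 2 ≡ᵇ 1 then 2 else 3) else 1)
  byParity = grundy-T-by-parity n m 1≤n 1≤m
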